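{- Let $L$ be a residuated lattice and $n\geq 1$ an integer. The following conditions are equivalent: (i) $L$ is an $n$-fold implicative residuated lattice; (ii) every filter of $L$ is an $n$-fold implicative filter of $L$; (iii) $\{1\}$ is an $n$-fold implicative filter of $L$; (iv) $x^n=x^{2n}$ for all $x\in L$.
   Context: A residuated lattice is an algebra $(L,\wedge,\vee,\otimes,\rightarrow,0,1)$ such that $(L,\wedge,\vee,0,1)$ is a bounded lattice, $(L,\otimes,1)$ is a commutative monoid, and $x\otimes y\leq z$ iff $x\leq y\rightarrow z$. A filter of $L$ is a nonempty subset closed under $\otimes$ and upward closed. For $x\in L$ and $k\geq1$, $x^k=x\otimes\cdots\otimes x$ ($k$ factors). $L$ is an $n$-fold implicative residuated lattice if $x^{n+1}=x^n$ for all $x\in L$. A subset $F\subseteq L$ is an $n$-fold implicative filter if $1\in F$ and for all $x,y,z\in L$: $x^n\rightarrow(y\rightarrow z)\in F$ and $x^n\rightarrow y\in F$ imply $x^n\rightarrow z\in F$. -}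

module Defs where

open import Level using (Level; _⊔_; suc)
open import Data.Nat using (ℕ; zero) renaming (suc to sucℕ)
open import Data.Product using (_×_; ∃)
open import Relation.Binary.PropositionalEquality using (_≡_)
open import Algebra.Lattice.Structures using (IsLattice)
open import Algebra.Structures using (IsCommutativeMonoid)

record ResiduatedLattice (a : Level) : Set (suc a) where
  infixr 6 _∨_
  infixr 7 _∧_
  infixr 7 _⊗_
  infixr 5 _⇒_
  infix 4 _≤_
  field
    Carrier : Set a
    _∧_ _∨_ _⊗_ _⇒_ : Carrier → Carrier → Carrier
    𝟎 𝟏 : Carrier
    isLattice : IsLattice _≡_ _∨_ _∧_

  _≤_ : Carrier → Carrier → Set a
  x ≤ y = x ∧ y ≡ x

  field
    bottom : ∀ x → 𝟎 ≤ x
    top    : ∀ x → x ≤ 𝟏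
    isCommutativeMonoid : IsCommutativeMonoid _≡_ _⊗_ 𝟏
    residuation-⇒ : ∀ x y z → x ⊗ y ≤ z → x ≤ y ⇒ z
    residuation-⇐ : ∀ x y z → x ≤ y ⇒ z → x ⊗ y ≤ z

module _ {a : Level} (L : ResiduatedLattice a) where
  open ResiduatedLattice L

  _^_ : Carrier → ℕ → Carrier
  x ^ zero = 𝟏
  x ^ sucℕ k = x ⊗ (x ^ k)

  Subset : Set (suc a)
  Subset = Carrier → Set a

  IsFilter : Subset → Set a
  IsFilter F = ∃ F
             × (∀ x y → F x → F y → F (x ⊗ y))
             × (∀ x y → F x → x ≤ y → F y)

  IsNFoldImplicativeRL : ℕ → Set a
  IsNFoldImplicativeRL n = ∀ x → x ^ sucℕ n ≡ x ^ n

  IsNFoldImplicativeFilter : ℕ → Subset → Set a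
  IsNFoldImplicativeFilter n F =
    F 𝟏 × (∀ x y z → F ((x ^ n) ⇒ (y ⇒ z)) → F ((x ^ n) ⇒ y) → F ((x ^ n) ⇒ z))

  ｛𝟏｝ : Subset
  ｛𝟏｝ x = x ≡ 𝟏

-- If x^n = x^(2n) then x^n = x^(2n) ≤ x^(n+1) ≤ x^n, since powers decrease and
-- n + 1 ≤ 2n. Conversely, in an n-fold implicative lattice every e = x^n is
-- idempotent, and for idempotent e Frege's axiom (e ⇒ (y ⇒ z)) ⊗ (e ⇒ y) ≤ e ⇒ z
-- holds, so an upward closed, ⊗-closed set containing both premises contains the
-- conclusion. Finally u ⇒ v = 1 iff u ≤ v, so {1} being n-fold implicative, applied
-- to y = x^n and z = x^(2n), yields x^n ≤ x^n ⊗ x^n = x^(2n).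
module Submission where

open import Defs
open import Level using (Level)
open import Data.Nat using (ℕ; _≤_; _+_; _∸_; zero; suc)
open import Data.Nat.Properties using (m+[n∸m]≡n; m≤m+n; n≤1+n; +-monoˡ-≤)
open import Data.Product using (_×_; _,_)
open import Relation.Binary.PropositionalEquality
open import Relation.Binary.Bundles using (Poset)
import Relation.Binary.Reasoning.PartialOrder as PosetReasoning
open import Algebra.Bundles using (CommutativeSemigroup)
import Algebra.Lattice.Bundles as LatticeBundles
import Algebra.Lattice.Properties.Lattice as LatticeProperties
import Algebra.Properties.CommutativeSemigroup as CommutativeSemigroupProperties
import Algebra.Structures

module ResiduatedLatticeProperties {a : Level} (L : ResiduatedLattice a) where
  open ResiduatedLattice L renaming (_≤_ to _≼_)
  open Algebra.Structures.IsCommutativeMonoid isCommutativeMonoid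
    using (assoc; comm; identityˡ; identityʳ; isCommutativeSemigroup)

  infixr 8 _^ᴸ_
  _^ᴸ_ : Carrier → ℕ → Carrier
  _^ᴸ_ = _^_ L

  lattice : LatticeBundles.Lattice a a
  lattice = record { isLattice = isLattice }

  ⊗-commutativeSemigroup : CommutativeSemigroup a a
  ⊗-commutativeSemigroup = record { isCommutativeSemigroup = isCommutativeSemigroup }

  open CommutativeSemigroupProperties ⊗-commutativeSemigroup using (interchange)

  -- The library orders a lattice by x ≡ x ∧ y; the record uses x ∧ y ≡ x.
  private module ∧-poset = Poset (LatticeProperties.poset lattice)

  ≼-refl : ∀ {x} → x ≼ x
  ≼-refl = sym ∧-poset.refl

  ≼-trans : ∀ {x y z} → x ≼ y → y ≼ z → x ≼ z
  ≼-trans p q = sym (∧-poset.trans (sym p) (sym q))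

  ≼-antisym : ∀ {x y} → x ≼ y → y ≼ x → x ≡ y
  ≼-antisym p q = ∧-poset.antisym (sym p) (sym q)

  ≼-reflexive : ∀ {x y} → x ≡ y → x ≼ y
  ≼-reflexive refl = ≼-refl

  ≼-poset : Poset a a a
  ≼-poset = record
    { _≤_ = _≼_
    ; isPartialOrder = record
      { isPreorder = record
        { isEquivalence = isEquivalence
        ; reflexive = ≼-reflexive
        ; trans = ≼-trans
        }
      ; antisym = ≼-antisym
      }
    }

  module ≼-Reasoning = PosetReasoning ≼-poset

  ⊗-monoˡ-≼ : ∀ {x y} c → x ≼ y → x ⊗ c ≼ y ⊗ c
  ⊗-monoˡ-≼ {x} {y} c x≼y =
    residuation-⇐ x c (y ⊗ c) (≼-trans x≼y (residuation-⇒ y c (y ⊗ c) ≼-refl))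

  ⊗-monoʳ-≼ : ∀ {x y} c → x ≼ y → c ⊗ x ≼ c ⊗ y
  ⊗-monoʳ-≼ {x} {y} c x≼y = subst₂ _≼_ (comm x c) (comm y c) (⊗-monoˡ-≼ c x≼y)

  ⊗-mono-≼ : ∀ {x y u v} → x ≼ y → u ≼ v → x ⊗ u ≼ y ⊗ v
  ⊗-mono-≼ {y = y} {u} x≼y u≼v = ≼-trans (⊗-monoˡ-≼ u x≼y) (⊗-monoʳ-≼ y u≼v)

  ⇒-eval : ∀ x y → (x ⇒ y) ⊗ x ≼ y
  ⇒-eval x y = residuation-⇐ (x ⇒ y) x y ≼-refl

  ⇒≡𝟏⇒≼ : ∀ {x y} → x ⇒ y ≡ 𝟏 → x ≼ y
  ⇒≡𝟏⇒≼ {x} {y} x⇒y≡𝟏 =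
    subst (_≼ y) (identityˡ x) (residuation-⇐ 𝟏 x y (≼-reflexive (sym x⇒y≡𝟏)))

  ≼⇒⇒≡𝟏 : ∀ {x y} → x ≼ y → x ⇒ y ≡ 𝟏
  ≼⇒⇒≡𝟏 {x} {y} x≼y =
    ≼-antisym (top _) (residuation-⇒ 𝟏 x y (subst (_≼ y) (sym (identityˡ x)) x≼y))

  -- Frege's axiom; idempotence lets the antecedent e be used twice.
  idempotent⇒frege : ∀ {e} y z → e ⊗ e ≡ e → (e ⇒ (y ⇒ z)) ⊗ (e ⇒ y) ≼ e ⇒ z
  idempotent⇒frege {e} y z e⊗e≡e = residuation-⇒ _ e z (begin
    ((e ⇒ (y ⇒ z)) ⊗ (e ⇒ y)) ⊗ e        ≡⟨ cong (((e ⇒ (y ⇒ z)) ⊗ (e ⇒ y)) ⊗_) (sym e⊗e≡e) ⟩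
    ((e ⇒ (y ⇒ z)) ⊗ (e ⇒ y)) ⊗ (e ⊗ e)  ≡⟨ interchange _ _ e e ⟩
    ((e ⇒ (y ⇒ z)) ⊗ e) ⊗ ((e ⇒ y) ⊗ e)  ≤⟨ ⊗-mono-≼ (⇒-eval e (y ⇒ z)) (⇒-eval e y) ⟩
    (y ⇒ z) ⊗ y                          ≤⟨ ⇒-eval y z ⟩
    z                                    ∎)
    where open ≼-Reasoning

  ^-+ : ∀ x m k → x ^ᴸ (m + k) ≡ x ^ᴸ m ⊗ x ^ᴸ k
  ^-+ x zero    k = sym (identityˡ _)
  ^-+ x (suc m) k = trans (cong (x ⊗_) (^-+ x m k)) (sym (assoc x _ _))

  ^-antitone : ∀ x {m k} → m ≤ k → x ^ᴸ k ≼ x ^ᴸ m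
  ^-antitone x {m} {k} m≤k = begin
    x ^ᴸ k                    ≡⟨ cong (x ^ᴸ_) (m+[n∸m]≡n m≤k) ⟨
    x ^ᴸ (m + (k ∸ m))        ≡⟨ ^-+ x m (k ∸ m) ⟩
    x ^ᴸ m ⊗ x ^ᴸ (k ∸ m)     ≤⟨ ⊗-monoʳ-≼ (x ^ᴸ m) (top _) ⟩
    x ^ᴸ m ⊗ 𝟏                ≡⟨ identityʳ _ ⟩
    x ^ᴸ m                    ∎
    where open ≼-Reasoning

  nFold⇒^-+-stable : ∀ n → IsNFoldImplicativeRL L n → ∀ x k → x ^ᴸ (k + n) ≡ x ^ᴸ n
  nFold⇒^-+-stable n h x zero    = refl
  nFold⇒^-+-stable n h x (suc k) = trans (cong (x ⊗_) (nFold⇒^-+-stable n h x k)) (h x)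

  nFold⇒^-idempotent : ∀ n → IsNFoldImplicativeRL L n → ∀ x → x ^ᴸ n ⊗ x ^ᴸ n ≡ x ^ᴸ n
  nFold⇒^-idempotent n h x = trans (sym (^-+ x n n)) (nFold⇒^-+-stable n h x n)

  ｛𝟏｝-isFilter : IsFilter L (｛𝟏｝ L)
  ｛𝟏｝-isFilter =
    (𝟏 , refl) ,
    (λ { _ _ refl refl → identityˡ 𝟏 }) ,
    (λ { _ y refl 𝟏≼y → ≼-antisym (top y) 𝟏≼y })

  filter-𝟏 : ∀ {F} → IsFilter L F → F 𝟏
  filter-𝟏 ((x , Fx) , _ , up) = up x 𝟏 Fx (top x)

  nFold⇒filter-nFold : ∀ n → IsNFoldImplicativeRL L n →
                       ∀ F → IsFilter L F → IsNFoldImplicativeFilter L n F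
  nFold⇒filter-nFold n h _ isFilter@(_ , ⊗-closed , up) =
    filter-𝟏 isFilter ,
    λ x y z F[xⁿ⇒y⇒z] F[xⁿ⇒y] →
      up _ _ (⊗-closed _ _ F[xⁿ⇒y⇒z] F[xⁿ⇒y])
             (idempotent⇒frege y z (nFold⇒^-idempotent n h x))

  ｛𝟏｝-nFold⇒^-doubling : ∀ n → IsNFoldImplicativeFilter L n (｛𝟏｝ L) →
                          ∀ x → x ^ᴸ n ≡ x ^ᴸ (n + n)
  ｛𝟏｝-nFold⇒^-doubling n (_ , mp) x =
    ≼-antisym (⇒≡𝟏⇒≼ (mp x xⁿ (x ^ᴸ (n + n)) (≼⇒⇒≡𝟏 xⁿ≼xⁿ⇒x²ⁿ) (≼⇒⇒≡𝟏 ≼-refl)))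
              (^-antitone x (m≤m+n n n))
    where
    xⁿ : Carrier
    xⁿ = x ^ᴸ n
    xⁿ≼xⁿ⇒x²ⁿ : xⁿ ≼ xⁿ ⇒ x ^ᴸ (n + n)
    xⁿ≼xⁿ⇒x²ⁿ = residuation-⇒ xⁿ xⁿ _ (≼-reflexive (sym (^-+ x n n)))

  ^-doubling⇒nFold : ∀ n → 1 ≤ n → (∀ x → x ^ᴸ n ≡ x ^ᴸ (n + n)) → IsNFoldImplicativeRL L n
  ^-doubling⇒nFold n 1≤n h x = ≼-antisym (^-antitone x (n≤1+n n)) (begin
    x ^ᴸ n        ≡⟨ h x ⟩
    x ^ᴸ (n + n)  ≤⟨ ^-antitone x (+-monoˡ-≤ n 1≤n) ⟩
    x ^ᴸ suc n    ∎)
    where open ≼-Reasoning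

open ResiduatedLatticeProperties

proposition4p14 : {a : Level} (L : ResiduatedLattice a) (n : ℕ) → 1 ≤ n →
    let open ResiduatedLattice L in
    let _^ᴸ_ = _^_ L in
    (IsNFoldImplicativeRL L n → (∀ F → IsFilter L F → IsNFoldImplicativeFilter L n F))
    × ((∀ F → IsFilter L F → IsNFoldImplicativeFilter L n F) → IsNFoldImplicativeFilter L n (｛𝟏｝ L))
    × (IsNFoldImplicativeFilter L n (｛𝟏｝ L) → (∀ x → x ^ᴸ n ≡ x ^ᴸ (n + n)))
    × ((∀ x → x ^ᴸ n ≡ x ^ᴸ (n + n)) → IsNFoldImplicativeRL L n)
proposition4p14 L n 1≤n =
  nFold⇒filter-nFold L n ,
  (λ allFilters → allFilters (｛𝟏｝ L) (｛𝟏｝-isFilter L)) ,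
  ｛𝟏｝-nFold⇒^-doubling L n ,
  ^-doubling⇒nFold L n 1≤n
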